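{- Let $j$ be a positive integer and $D$ a $(2,j)$ digraph such that $P(D)$ contains a hole $H$. Then no vertex on $H$ takes care of an edge on $H$.
   Context: All digraphs are finite and simple. A $(2,j)$ digraph is an acyclic digraph in which every vertex has indegree at most $2$ and outdegree at most $j$. For an acyclic digraph $D$: $U(D)$ is the simple graph on $V(D)$ with edges $uv$ whenever $(u,v)$ or $(v,u)$ is an arc; $C(D)$ has edges $uv$ ($u\ne v$) whenever $u,v$ have a common out-neighbor; the phylogeny graph $P(D)$ has edge set $E(U(D))\cup E(C(D))$. A hole is an induced cycle of length at least four. An edge $xy$ of $P(D)$ is a cared edge if it is in $C(D)$ but not in $U(D)$; a vertex $v$ takes care of the cared edge $xy$ if $v$ is a common out-neighbor of $x$ and $y$ in $D$. -}

module Defs where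

open import Data.Nat using (ℕ; zero; suc; _≤_)
open import Data.Fin using (Fin; toℕ)
open import Data.Bool using (Bool; true; false; if_then_else_)
open import Data.List using (List; map; allFin)
open import Data.Nat.ListAction using (sum)
open import Data.Product using (_×_; ∃)
open import Data.Sum using (_⊎_)
open import Relation.Nullary using (¬_)
open import Relation.Binary.PropositionalEquality using (_≡_; _≢_)
open import Function.Definitions using (Injective)

-- A finite digraph on vertex set Fin n, given by its (Boolean) arc relation.
-- A Boolean adjacency relation rules out multiple arcs automatically.
record Digraph : Set where
  field
    n   : ℕ
    arc : Fin n → Fin n → Bool

open Digraph public

Arc : (D : Digraph) → Fin (n D) → Fin (n D) → Set
Arc D u v = arc D u v ≡ true

data Reach (D : Digraph) : Fin (n D) → Fin (n D) → Set where
  step : ∀ {u v} → Arc D u v → Reach D u v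
  cons : ∀ {u w v} → Arc D u w → Reach D w v → Reach D u v

-- acyclic (in particular loopless, so D is simple)
Acyclic : Digraph → Set
Acyclic D = ∀ v → ¬ Reach D v v

indeg : (D : Digraph) → Fin (n D) → ℕ
indeg D v = sum (map (λ u → if arc D u v then 1 else 0) (allFin (n D)))

outdeg : (D : Digraph) → Fin (n D) → ℕ
outdeg D u = sum (map (λ v → if arc D u v then 1 else 0) (allFin (n D)))

Is2j : ℕ → Digraph → Set
Is2j j D = Acyclic D × (∀ v → indeg D v ≤ 2) × (∀ v → outdeg D v ≤ j)

UAdj : (D : Digraph) → Fin (n D) → Fin (n D) → Set
UAdj D u v = Arc D u v ⊎ Arc D v u

CAdj : (D : Digraph) → Fin (n D) → Fin (n D) → Set
CAdj D u v = u ≢ v × ∃ λ w → Arc D u w × Arc D v w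

PAdj : (D : Digraph) → Fin (n D) → Fin (n D) → Set
PAdj D u v = UAdj D u v ⊎ CAdj D u v

Cared : (D : Digraph) → Fin (n D) → Fin (n D) → Set
Cared D x y = CAdj D x y × ¬ UAdj D x y

TakesCare : (D : Digraph) → Fin (n D) → Fin (n D) → Fin (n D) → Set
TakesCare D v x y = Cared D x y × Arc D x v × Arc D y v

CycAdj : (k : ℕ) → Fin k → Fin k → Set
CycAdj k i j =
  (toℕ j ≡ suc (toℕ i)) ⊎ (toℕ i ≡ suc (toℕ j))
  ⊎ (toℕ i ≡ 0 × suc (toℕ j) ≡ k) ⊎ (toℕ j ≡ 0 × suc (toℕ i) ≡ k)

IsHole : (D : Digraph) (k : ℕ) → (Fin k → Fin (n D)) → Set
IsHole D k h =
  4 ≤ k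
  × Injective _≡_ _≡_ h
  × (∀ i j → CycAdj k i j → PAdj D (h i) (h j))
  × (∀ i j → i ≢ j → ¬ CycAdj k i j → ¬ PAdj D (h i) (h j))

module Submission where

-- Suppose h a → v ← h b.  Acyclicity forbids loops, so v differs from
-- h a and h b, and the two arcs make v adjacent in P(D) to both ends of the
-- edge.  A hole is induced, so l would be cyclically adjacent to a and to b,
-- while a and b are cyclically adjacent too: a triangle in the cycle C_k.
-- For k ≥ 4 the cycle C_k has no triangle, which is the combinatorial core.

open import Defs
open import Data.Nat using (ℕ; suc; _≤_; _<_; s≤s; z≤n)
open import Data.Nat.Properties using (<-irrefl; ≤⇒≯)
open import Data.Fin using (Fin; toℕ)
open import Data.Fin.Properties using (toℕ<n; toℕ-injective)
open import Data.Product using (_×_; _,_)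
open import Data.Sum using (_⊎_; inj₁; inj₂)
open import Data.Empty using (⊥; ⊥-elim)
open import Relation.Nullary using (¬_)
open import Relation.Binary.PropositionalEquality using (_≡_; _≢_; refl; sym; cong)

CycSucc : ℕ → ℕ → ℕ → Set
CycSucc k x y = (y ≡ suc x) ⊎ (y ≡ 0 × suc x ≡ k)

cycSucc-functional : ∀ {k x y z} → y < k → z < k →
  CycSucc k x y → CycSucc k x z → y ≡ z
cycSucc-functional _   _   (inj₁ refl)          (inj₁ refl)          = refl
cycSucc-functional y<k _   (inj₁ refl)          (inj₂ (refl , refl)) = ⊥-elim (<-irrefl refl y<k)
cycSucc-functional _   z<k (inj₂ (refl , refl)) (inj₁ refl)          = ⊥-elim (<-irrefl refl z<k)
cycSucc-functional _   _   (inj₂ (refl , _))    (inj₂ (refl , _))    = refl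

cycSucc-injective : ∀ {k x y z} → CycSucc k x z → CycSucc k y z → x ≡ y
cycSucc-injective (inj₁ refl)       (inj₁ refl)        = refl
cycSucc-injective (inj₁ refl)       (inj₂ (() , _))
cycSucc-injective (inj₂ (refl , _)) (inj₁ ())
cycSucc-injective (inj₂ (_ , refl)) (inj₂ (_ , refl))  = refl

-- Going around a directed 3-cycle of successors traverses the whole cycle,
-- so the cycle has length at most 3.  (Without a wrap-around step we would
-- have x = x + 3; with one, the wrap-around pins k to 1 or 3.)
cycSucc-3cycle : ∀ {k x y z} →
  CycSucc k x y → CycSucc k y z → CycSucc k z x → k ≤ 3
cycSucc-3cycle (inj₁ refl)          (inj₁ refl)          (inj₁ ())
cycSucc-3cycle (inj₁ refl)          (inj₁ refl)          (inj₂ (refl , refl)) = s≤s (s≤s (s≤s z≤n))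
cycSucc-3cycle (inj₁ refl)          (inj₂ (refl , refl)) (inj₁ refl)          = s≤s (s≤s (s≤s z≤n))
cycSucc-3cycle (inj₁ refl)          (inj₂ (refl , refl)) (inj₂ (refl , ()))
cycSucc-3cycle (inj₂ (refl , refl)) (inj₁ refl)          (inj₁ refl)          = s≤s (s≤s (s≤s z≤n))
cycSucc-3cycle (inj₂ (refl , refl)) (inj₁ refl)          (inj₂ (refl , ()))
cycSucc-3cycle (inj₂ (refl , refl)) (inj₂ (refl , refl)) _                    = s≤s z≤n

Linked : ℕ → ℕ → ℕ → Set
Linked k x y = CycSucc k x y ⊎ CycSucc k y x

-- Orient each of the three
-- edges by the successor relation: a vertex with two successors contradicts
-- functionality, one with two predecessors contradicts injectivity, and the
-- remaining orientations are directed 3-cycles, which force k ≤ 3.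
linked-triangle-free : ∀ {k x y z} → 4 ≤ k → x < k → y < k → z < k →
  x ≢ y → x ≢ z → y ≢ z → Linked k x y → Linked k x z → Linked k y z → ⊥
linked-triangle-free {k} {x} {y} {z} 4≤k x<k y<k z<k x≢y x≢z y≢z = orient
  where
    k≰3 : ¬ k ≤ 3
    k≰3 k≤3 = ≤⇒≯ k≤3 4≤k

    orient : Linked k x y → Linked k x z → Linked k y z → ⊥
    orient (inj₁ x→y) (inj₁ x→z) _          = y≢z (cycSucc-functional y<k z<k x→y x→z)
    orient (inj₂ y→x) (inj₂ z→x) _          = y≢z (cycSucc-injective y→x z→x)
    orient (inj₁ x→y) (inj₂ z→x) (inj₁ y→z) = k≰3 (cycSucc-3cycle x→y y→z z→x)
    orient (inj₁ x→y) (inj₂ z→x) (inj₂ z→y) = x≢y (cycSucc-functional x<k y<k z→x z→y)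
    orient (inj₂ y→x) (inj₁ x→z) (inj₁ y→z) = x≢z (cycSucc-functional x<k z<k y→x y→z)
    orient (inj₂ y→x) (inj₁ x→z) (inj₂ z→y) = k≰3 (cycSucc-3cycle x→z z→y y→x)

cycAdj⇒linked : ∀ {k} {i j : Fin k} → CycAdj k i j → Linked k (toℕ i) (toℕ j)
cycAdj⇒linked (inj₁ j≡1+i)               = inj₁ (inj₁ j≡1+i)
cycAdj⇒linked (inj₂ (inj₁ i≡1+j))        = inj₂ (inj₁ i≡1+j)
cycAdj⇒linked (inj₂ (inj₂ (inj₁ wrap)))  = inj₂ (inj₂ wrap)
cycAdj⇒linked (inj₂ (inj₂ (inj₂ wrap)))  = inj₁ (inj₂ wrap)

cycAdj-triangle-free : ∀ {k} {a b c : Fin k} → 4 ≤ k → a ≢ b → a ≢ c → b ≢ c →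
  CycAdj k a b → CycAdj k a c → CycAdj k b c → ⊥
cycAdj-triangle-free {a = a} {b} {c} 4≤k a≢b a≢c b≢c ab ac bc =
  linked-triangle-free 4≤k (toℕ<n a) (toℕ<n b) (toℕ<n c)
    (distinct a≢b) (distinct a≢c) (distinct b≢c)
    (cycAdj⇒linked ab) (cycAdj⇒linked ac) (cycAdj⇒linked bc)
  where
    distinct : ∀ {i j : Fin _} → i ≢ j → toℕ i ≢ toℕ j
    distinct i≢j e = i≢j (toℕ-injective e)

hole-induced : ∀ {D k h} → IsHole D k h → ∀ {i j} → i ≢ j →
  PAdj D (h i) (h j) → ¬ ¬ CycAdj k i j
hole-induced (_ , _ , _ , chordless) i≢j adj notCyc = chordless _ _ i≢j notCyc adj

-- No vertex of a hole other than the ends of a hole edge is adjacent in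
-- P(D) to both ends; otherwise the cycle would contain a triangle.
hole-edge-no-common-neighbour : ∀ {D k h} → IsHole D k h → ∀ {l a b} →
  l ≢ a → l ≢ b → a ≢ b → CycAdj k a b →
  PAdj D (h l) (h a) → PAdj D (h l) (h b) → ⊥
hole-edge-no-common-neighbour {D} hole@(4≤k , _) l≢a l≢b a≢b ab la lb =
  hole-induced {D} hole l≢a la λ cla →
  hole-induced {D} hole l≢b lb λ clb →
  cycAdj-triangle-free 4≤k l≢a l≢b a≢b cla clb ab

arc-ends-distinct : ∀ {D} → Acyclic D → ∀ {u v} → Arc D u v → u ≢ v
arc-ends-distinct acyclic u→v refl = acyclic _ (step u→v)

-- Proposition 3.1.  If h l took care of the hole edge h a h b, the arcs
-- h a → h l ← h b would make h l a common P(D)-neighbour of both ends.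
proposition3p1 : (j : ℕ) → 1 ≤ j → (D : Digraph) → Is2j j D →
    (k : ℕ) (h : Fin k → Fin (n D)) → IsHole D k h →
    (l a b : Fin k) → CycAdj k a b → ¬ TakesCare D (h l) (h a) (h b)
proposition3p1 j _ D (acyclic , _) k h hole l a b ab (((ha≢hb , _) , _) , a→l , b→l) =
  hole-edge-no-common-neighbour {D} hole l≢a l≢b a≢b ab (inj₁ (inj₂ a→l)) (inj₁ (inj₂ b→l))
  where
    l≢a : l ≢ a
    l≢a l≡a = arc-ends-distinct {D} acyclic a→l (cong h (sym l≡a))

    l≢b : l ≢ b
    l≢b l≡b = arc-ends-distinct {D} acyclic b→l (cong h (sym l≡b))

    a≢b : a ≢ b
    a≢b a≡b = ha≢hb (cong h a≡b)
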